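{- Let $q$ be a power of an odd prime, let $\lambda\in\mathbb{F}_q$ be a non-square, and let $f\in\mathbb{F}_q[X]$ be a permutation polynomial of $\mathbb{F}_q$. Let $H$ be any Hamiltonian cycle of any (weakly) connected component of $\mathcal{G}(\lambda,f)$, and let $s$ be the binary sequence obtained by recording, in order along $H$, the weights of the edges of $H$. Then $s$ is balancing: the numbers of $0$'s and of $1$'s in $s$ differ by at most $1$.
   Context: For a polynomial $f\in\mathbb{F}_q[X]$ and a non-square $\lambda\in\mathbb{F}_q$, $\mathcal{G}(\lambda,f)$ is the directed graph with vertex set $\mathbb{F}_q$ and an edge from $x$ to $y$ iff $(y^2-f(x))(\lambda y^2-f(x))=0$ (loops allowed). Weights: an edge $(x,y)$ has weight $0$ if $y^2=f(x)$ and weight $1$ otherwise (i.e. if $\lambda y^2=f(x)$ and $y^2\neq f(x)$); in particular the edge going to the vertex $0$ has weight $0$. -}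

module Defs where

open import Level using (0ℓ)
open import Data.Nat using (ℕ; zero; suc; _^_; _≤_; _<_)
import Data.Nat as ℕ
open import Data.Nat.Primality using (Prime)
open import Data.Fin using (Fin; toℕ)
open import Data.List using (List; []; _∷_; length; filter)
open import Data.List.Base using (allFin)
open import Data.Product using (Σ; ∃; _×_; _,_)
open import Data.Sum using (_⊎_)
open import Relation.Nullary using (¬_; Dec; yes; no)
open import Relation.Binary.PropositionalEquality using (_≡_; _≢_)
open import Algebra.Structures using (IsCommutativeRing)
open import Function.Bundles using (_↔_)
open import Function.Definitions using (Injective)

record FiniteField (q : ℕ) : Set₁ where
  infixl 6 _+_
  infixl 7 _*_
  field
    Carrier : Set
    _+_ _*_ : Carrier → Carrier → Carrier
    -_      : Carrier → Carrier
    0# 1#   : Carrier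
    isCommutativeRing : IsCommutativeRing _≡_ _+_ _*_ -_ 0# 1#
    _≟_     : (x y : Carrier) → Dec (x ≡ y)
    0≢1     : 0# ≢ 1#
    inverse : (x : Carrier) → x ≢ 0# → Σ Carrier (λ y → x * y ≡ 1#)
    finite  : Carrier ↔ Fin q

-- auxiliary successor (used below only away from the last index)
nextAux : ∀ {k} → Fin (suc k) → Fin (suc k)
nextAux {zero}  _            = Fin.zero
nextAux {suc k} Fin.zero     = Fin.suc Fin.zero
nextAux {suc k} (Fin.suc j)  = Fin.suc (nextAux j)

next : ∀ {m} → Fin m → Fin m
next {suc m} i with suc (toℕ i) ℕ.≟ suc m
... | yes _ = Fin.zero
... | no  _ = nextAux i

module _ {q : ℕ} (F : FiniteField q) where
  open FiniteField F

  -- Polynomials over F, as lists of coefficients (constant term first).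
  Poly : Set
  Poly = List Carrier

  eval : Poly → Carrier → Carrier
  eval []       x = 0#
  eval (c ∷ cs) x = c + x * eval cs x

  IsPermutationPolynomial : Poly → Set
  IsPermutationPolynomial f = Injective _≡_ _≡_ (eval f)
                            × (∀ y → Σ Carrier (λ x → eval f x ≡ y))

  IsSquare : Carrier → Set
  IsSquare a = Σ Carrier (λ y → y * y ≡ a)

  _-_ : Carrier → Carrier → Carrier
  a - b = a + (- b)

  Edge : Carrier → Poly → Carrier → Carrier → Set
  Edge λ' f x y = ((y * y) - eval f x) * ((λ' * (y * y)) - eval f x) ≡ 0#

  weight : Poly → Carrier → Carrier → ℕ
  weight f x y with (y * y) ≟ eval f x
  ... | yes _ = 0
  ... | no  _ = 1

  data Reach (λ' : Carrier) (f : Poly) (x : Carrier) : Carrier → Set where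
    here : Reach λ' f x x
    step : ∀ {y z} → Reach λ' f x y → (Edge λ' f y z ⊎ Edge λ' f z y) → Reach λ' f x z

  record IsWeakComponent (λ' : Carrier) (f : Poly) (C : Carrier → Set) : Set where
    field
      nonempty  : Σ Carrier C
      connected : ∀ x y → C x → C y → Reach λ' f x y
      maximal   : ∀ x y → C x → Reach λ' f x y → C y

  record HamiltonianCycle (λ' : Carrier) (f : Poly) (C : Carrier → Set) : Set where
    field
      len       : ℕ
      len≥1     : 1 ≤ len
      vertex    : Fin len → Carrier
      distinct  : Injective _≡_ _≡_ vertex
      inC       : ∀ i → C (vertex i)
      covers    : ∀ x → C x → Σ (Fin len) (λ i → vertex i ≡ x)
      edges     : ∀ i → Edge λ' f (vertex i) (vertex (next i))

  weightSeq : ∀ {λ' f C} → (H : HamiltonianCycle λ' f C) → Fin (HamiltonianCycle.len H) → ℕ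
  weightSeq {f = f} H i = weight f (vertex i) (vertex (next i))
    where open HamiltonianCycle H

Balancing : ∀ {m} → (Fin m → ℕ) → Set
Balancing {m} s = (c0 ≤ c1 ℕ.+ 1) × (c1 ≤ c0 ℕ.+ 1)
  where
    c0 = length (filter (λ i → s i ℕ.≟ 0) (allFin m))
    c1 = length (filter (λ i → s i ℕ.≟ 1) (allFin m))

-- Let the i-th edge of H be vᵢ → yᵢ. Since v → y is an edge iff v → -y is, and H
-- covers a whole component, -yᵢ is again the target of some edge of H: this defines a
-- partner map σ on the edges. Because f is injective, an edge is determined by the
-- square of its target and its weight (f(v) = y² for weight 0, f(v) = λy² for weight 1),
-- so σ is injective on each weight class and never preserves the weight unless σ(i) = i.
-- A fixed point has yᵢ = -yᵢ, i.e. yᵢ = 0 (the existence of a non-square rules out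
-- characteristic 2), so there is at most one, and it has weight 0. Hence σ maps the
-- weight-1 edges injectively to weight-0 edges, and all weight-0 edges but one injectively
-- to weight-1 edges.
module Submission where

open import Defs
open import Level using (0ℓ)
open import Data.Nat using (ℕ; zero; suc; _^_; _≤_)
import Data.Nat as ℕ
import Data.Nat.Properties as ℕ
open import Data.Nat.Primality using (Prime)
open import Data.Fin using (Fin; toℕ; fromℕ; inject₁; punchOut)
open import Data.Fin.Properties as Fin
  using (injective⇒≤; punchOut-injective; toℕ-fromℕ; toℕ-inject₁; toℕ<n; any?)
open import Data.List using (List; _∷_; length; filter; lookup)
open import Data.List.Base using (allFin)
open import Data.List.Relation.Unary.All as All using (All)
open import Data.List.Relation.Unary.All.Properties using (all-filter)
open import Data.List.Relation.Unary.AllPairs using (_∷_)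
open import Data.List.Relation.Unary.Any using (index)
open import Data.List.Relation.Unary.Unique.Propositional using (Unique)
import Data.List.Relation.Unary.Unique.Propositional.Properties as Unique
open import Data.List.Membership.Propositional.Properties
  using (∈-filter⁺; ∈-allFin; ∈-lookup)
import Data.List.Membership.Setoid.Properties as SetoidMembership
open import Data.Product using (∃; _,_; proj₁; proj₂)
open import Data.Sum using (_⊎_; inj₁; inj₂)
open import Relation.Nullary using (¬_; Dec; yes; no; contradiction)
open import Relation.Unary using (Pred; Decidable)
open import Relation.Binary.PropositionalEquality
open import Function.Base using (_∘′_)
open import Function.Bundles using (_↔_; Inverse)
open import Function.Definitions using (Injective)
open import Algebra.Bundles using (CommutativeRing)

lookup-injective : ∀ {A : Set} {xs : List A} → Unique xs →
                   ∀ {i j} → lookup xs i ≡ lookup xs j → i ≡ j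
lookup-injective {xs = _ ∷ _}  _            {Fin.zero}  {Fin.zero}  _ = refl
lookup-injective {xs = _ ∷ xs} (x∉xs ∷ _)   {Fin.zero}  {Fin.suc j} e =
  contradiction e (All.lookup x∉xs (∈-lookup j))
lookup-injective {xs = _ ∷ xs} (x∉xs ∷ _)   {Fin.suc i} {Fin.zero}  e =
  contradiction (sym e) (All.lookup x∉xs (∈-lookup i))
lookup-injective {xs = _ ∷ _}  (_ ∷ unique) {Fin.suc i} {Fin.suc j} e =
  cong Fin.suc (lookup-injective unique e)

Fin-injective⇒surjective : ∀ {n} {f : Fin n → Fin n} → Injective _≡_ _≡_ f →
                           ∀ y → ∃ λ x → f x ≡ y
Fin-injective⇒surjective {zero}  {f} _     ()
Fin-injective⇒surjective {suc n} {f} f-inj y with any? (λ x → f x Fin.≟ y)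
... | yes hit = hit
... | no miss = contradiction (injective⇒≤ g-inj) ℕ.1+n≰n
  where
  y≢f : ∀ x → y ≢ f x
  y≢f x y≡fx = miss (x , sym y≡fx)

  g : Fin (suc n) → Fin n
  g x = punchOut (y≢f x)

  g-inj : Injective _≡_ _≡_ g
  g-inj {x} {x′} = f-inj ∘′ punchOut-injective (y≢f x) (y≢f x′)

finite-injective⇒surjective : ∀ {A : Set} {n} → A ↔ Fin n → {g : A → A} →
                              Injective _≡_ _≡_ g → ∀ y → ∃ λ x → g x ≡ y
finite-injective⇒surjective {n = n} A↔Fin {g} g-inj y =
  from x , (begin
    g (from x)                ≡⟨ sym (strictlyInverseʳ _) ⟩
    from (to (g (from x)))    ≡⟨ cong from gx≡y ⟩
    from (to y)               ≡⟨ strictlyInverseʳ y ⟩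
    y                         ∎)
  where
  open Inverse A↔Fin
  open ≡-Reasoning

  conjugate : Fin n → Fin n
  conjugate i = to (g (from i))

  conjugate-inj : Injective _≡_ _≡_ conjugate
  conjugate-inj {i} {j} e = begin
    i                     ≡⟨ sym (strictlyInverseˡ i) ⟩
    to (from i)           ≡⟨ cong to (g-inj (trans (sym (strictlyInverseʳ _))
                               (trans (cong from e) (strictlyInverseʳ _)))) ⟩
    to (from j)           ≡⟨ strictlyInverseˡ j ⟩
    j                     ∎

  x = proj₁ (Fin-injective⇒surjective conjugate-inj (to y))
  gx≡y = proj₂ (Fin-injective⇒surjective conjugate-inj (to y))

module _ {m : ℕ} {P : Pred (Fin m) 0ℓ} (P? : Decidable P) where

  count : ℕ
  count = length (filter P? (allFin m))

  position : ∀ {i} → P i → Fin count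
  position p = index (∈-filter⁺ P? (∈-allFin _) p)

  position-injective : ∀ {i j} (p : P i) (p′ : P j) → position p ≡ position p′ → i ≡ j
  position-injective p p′ =
    SetoidMembership.index-injective (setoid _) (∈-filter⁺ P? (∈-allFin _) p)
                                                (∈-filter⁺ P? (∈-allFin _) p′)

  count-≤ : ∀ {n} (h : ∀ {i} → P i → Fin n) →
            (∀ {i j} (p : P i) (p′ : P j) → h p ≡ h p′ → i ≡ j) → count ≤ n
  count-≤ h h-inj = injective⇒≤ {f = λ k → h (satisfies k)}
    (λ e → lookup-injective unique (h-inj (satisfies _) (satisfies _) e))
    where
    satisfies : ∀ k → P (lookup (filter P? (allFin m)) k)
    satisfies k = All.lookup (all-filter P? (allFin m)) (∈-lookup k)

    unique : Unique (filter P? (allFin m))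
    unique = Unique.filter⁺ P? (Unique.allFin⁺ m)

module _ {m : ℕ} (s : Fin m → ℕ) (σ : Fin m → Fin m)
  (binary              : ∀ i → s i ≡ 0 ⊎ s i ≡ 1)
  (injective-on-levels : ∀ {i j} → s i ≡ s j → σ i ≡ σ j → i ≡ j)
  (same-level⇒fixed    : ∀ {i} → s (σ i) ≡ s i → σ i ≡ i)
  (fixed⇒zero          : ∀ {i} → σ i ≡ i → s i ≡ 0)
  (fixed-unique        : ∀ {i j} → σ i ≡ i → σ j ≡ j → i ≡ j)
  where

  private
    is-zero? : Decidable (λ i → s i ≡ 0)
    is-zero? i = s i ℕ.≟ 0

    is-one? : Decidable (λ i → s i ≡ 1)
    is-one? i = s i ℕ.≟ 1

    zeros = count is-zero?
    ones  = count is-one?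

    one⇒partner-zero : ∀ {i} → s i ≡ 1 → s (σ i) ≡ 0
    one⇒partner-zero {i} sᵢ≡1 with binary (σ i)
    ... | inj₁ sσᵢ≡0 = sσᵢ≡0
    ... | inj₂ sσᵢ≡1 with () ← trans (sym sᵢ≡1) (fixed⇒zero (same-level⇒fixed (trans sσᵢ≡1 (sym sᵢ≡1))))

    zero⇒partner-one : ∀ {i} → s i ≡ 0 → σ i ≢ i → s (σ i) ≡ 1
    zero⇒partner-one {i} sᵢ≡0 moved with binary (σ i)
    ... | inj₂ sσᵢ≡1 = sσᵢ≡1
    ... | inj₁ sσᵢ≡0 = contradiction (same-level⇒fixed (trans sσᵢ≡0 (sym sᵢ≡0))) moved

    ones≤zeros : ones ≤ zeros
    ones≤zeros = count-≤ is-one? (λ p → position is-zero? (one⇒partner-zero p))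
      λ p p′ e → injective-on-levels (trans p (sym p′))
                   (position-injective is-zero? (one⇒partner-zero p) (one⇒partner-zero p′) e)

    slot : ∀ {i} → s i ≡ 0 → Dec (σ i ≡ i) → Fin (suc ones)
    slot _ (yes _)     = Fin.zero
    slot p (no  moved) = Fin.suc (position is-one? (zero⇒partner-one p moved))

    slot-injective : ∀ {i j} (p : s i ≡ 0) (p′ : s j ≡ 0) d d′ → slot p d ≡ slot p′ d′ → i ≡ j
    slot-injective p p′ (yes fixed) (yes fixed′) _ = fixed-unique fixed fixed′
    slot-injective p p′ (no moved)  (no moved′)  e =
      injective-on-levels (trans p (sym p′))
        (position-injective is-one? (zero⇒partner-one p moved) (zero⇒partner-one p′ moved′)
          (Fin.suc-injective e))

    zeros≤1+ones : zeros ≤ suc ones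
    zeros≤1+ones = count-≤ is-zero? (λ {i} p → slot p (σ i Fin.≟ i))
      λ {i} {j} p p′ → slot-injective p p′ (σ i Fin.≟ i) (σ j Fin.≟ j)

  balancing-by-partners : Balancing s
  balancing-by-partners =
    subst (zeros ≤_) (ℕ.+-comm 1 ones) zeros≤1+ones , ℕ.≤-trans ones≤zeros (ℕ.m≤m+n zeros 1)

module FieldProperties {q : ℕ} (F : FiniteField q) where
  open FiniteField F

  commutativeRing : CommutativeRing 0ℓ 0ℓ
  commutativeRing = record { isCommutativeRing = isCommutativeRing }

  open CommutativeRing commutativeRing public
    using (ring; +-assoc; *-comm; +-identityˡ; -‿inverseˡ; -‿inverseʳ; *-identityˡ;
           distribʳ; zeroˡ; zeroʳ; *-assoc)
  open import Algebra.Properties.Ring ring public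
    using (-‿distribˡ-*; -‿distribʳ-*; -‿involutive; -‿injective; x∙y⁻¹≈ε⇒x≈y;
           +-inverseˡ-unique; x[y-z]≈xy-xz)
  open ≡-Reasoning

  x*y≡0⇒x≡0⊎y≡0 : ∀ x y → x * y ≡ 0# → x ≡ 0# ⊎ y ≡ 0#
  x*y≡0⇒x≡0⊎y≡0 x y xy≡0 with x ≟ 0#
  ... | yes x≡0 = inj₁ x≡0
  ... | no  x≢0 with x⁻¹ , xx⁻¹≡1 ← inverse x x≢0 = inj₂ (begin
    y               ≡⟨ sym (*-identityˡ y) ⟩
    1# * y          ≡⟨ cong (_* y) (trans (sym xx⁻¹≡1) (*-comm x x⁻¹)) ⟩
    (x⁻¹ * x) * y   ≡⟨ *-assoc x⁻¹ x y ⟩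
    x⁻¹ * (x * y)   ≡⟨ cong (x⁻¹ *_) xy≡0 ⟩
    x⁻¹ * 0#        ≡⟨ zeroʳ x⁻¹ ⟩
    0#              ∎)

  -x*-x≡x*x : ∀ x → (- x) * (- x) ≡ x * x
  -x*-x≡x*x x = begin
    (- x) * (- x)   ≡⟨ sym (-‿distribˡ-* x (- x)) ⟩
    - (x * - x)     ≡⟨ cong -_ (sym (-‿distribʳ-* x x)) ⟩
    - - (x * x)     ≡⟨ -‿involutive (x * x) ⟩
    x * x           ∎

  [x+y]*[x-y]≡x*x-y*y : ∀ x y → (x + y) * (x + - y) ≡ x * x + - (y * y)
  [x+y]*[x-y]≡x*x-y*y x y = begin
    (x + y) * (x + - y)                          ≡⟨ distribʳ (x + - y) x y ⟩
    x * (x + - y) + y * (x + - y)                ≡⟨ cong₂ _+_ (x[y-z]≈xy-xz x x y) (x[y-z]≈xy-xz y x y) ⟩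
    (x * x + - (x * y)) + (y * x + - (y * y))    ≡⟨ cong (λ t → (x * x + - (x * y)) + (t + - (y * y))) (*-comm y x) ⟩
    (x * x + - (x * y)) + (x * y + - (y * y))    ≡⟨ +-assoc (x * x) _ _ ⟩
    x * x + (- (x * y) + (x * y + - (y * y)))    ≡⟨ cong (x * x +_) (sym (+-assoc _ _ _)) ⟩
    x * x + ((- (x * y) + x * y) + - (y * y))    ≡⟨ cong (λ t → x * x + (t + - (y * y))) (-‿inverseˡ (x * y)) ⟩
    x * x + (0# + - (y * y))                     ≡⟨ cong (x * x +_) (+-identityˡ _) ⟩
    x * x + - (y * y)                            ∎

  x*x≡y*y⇒x≡y⊎x≡-y : ∀ {x y} → x * x ≡ y * y → x ≡ y ⊎ x ≡ - y
  x*x≡y*y⇒x≡y⊎x≡-y {x} {y} sq with x*y≡0⇒x≡0⊎y≡0 (x + y) (x + - y) product≡0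
    where
    product≡0 : (x + y) * (x + - y) ≡ 0#
    product≡0 = trans ([x+y]*[x-y]≡x*x-y*y x y)
                  (trans (cong (_+ - (y * y)) sq) (-‿inverseʳ (y * y)))
  ... | inj₁ sum≡0  = inj₂ (+-inverseˡ-unique x y sum≡0)
  ... | inj₂ diff≡0 = inj₁ (x∙y⁻¹≈ε⇒x≈y x y diff≡0)

  [1+1]*x≡x+x : ∀ x → (1# + 1#) * x ≡ x + x
  [1+1]*x≡x+x x = trans (distribʳ x 1# 1#) (cong₂ _+_ (*-identityˡ x) (*-identityˡ x))

  1+1≡0⇒-x≡x : 1# + 1# ≡ 0# → ∀ x → - x ≡ x
  1+1≡0⇒-x≡x two≡0 x = sym (+-inverseˡ-unique x x (begin
    x + x                 ≡⟨ sym ([1+1]*x≡x+x x) ⟩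
    (1# + 1#) * x         ≡⟨ cong (_* x) two≡0 ⟩
    0# * x                ≡⟨ zeroˡ x ⟩
    0#                    ∎))

  -- In characteristic 2 squaring is injective, hence (F being finite) surjective.
  non-square⇒1+1≢0 : ∀ {a} → ¬ IsSquare F a → 1# + 1# ≢ 0#
  non-square⇒1+1≢0 {a} non-square two≡0 =
    non-square (finite-injective⇒surjective finite squaring-injective a)
    where
    squaring-injective : Injective _≡_ _≡_ (λ x → x * x)
    squaring-injective sq with x*x≡y*y⇒x≡y⊎x≡-y sq
    ... | inj₁ x≡y  = x≡y
    ... | inj₂ x≡-y = trans x≡-y (1+1≡0⇒-x≡x two≡0 _)

  x≡-x⇒x≡0 : 1# + 1# ≢ 0# → ∀ {x} → x ≡ - x → x ≡ 0#
  x≡-x⇒x≡0 two≢0 {x} x≡-x with x*y≡0⇒x≡0⊎y≡0 (1# + 1#) x (begin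
    (1# + 1#) * x         ≡⟨ [1+1]*x≡x+x x ⟩
    x + x                 ≡⟨ cong (x +_) x≡-x ⟩
    x + - x               ≡⟨ -‿inverseʳ x ⟩
    0#                    ∎)
  ... | inj₁ two≡0 = contradiction two≡0 two≢0
  ... | inj₂ x≡0   = x≡0

module GraphProperties {q : ℕ} (F : FiniteField q) (λ′ : FiniteField.Carrier F) (f : Poly F) where
  open FiniteField F
  open FieldProperties F

  edge-cases : ∀ {x y} → Edge F λ′ f x y → y * y ≡ eval F f x ⊎ λ′ * (y * y) ≡ eval F f x
  edge-cases {x} {y} e with x*y≡0⇒x≡0⊎y≡0 _ _ e
  ... | inj₁ weight-zero = inj₁ (x∙y⁻¹≈ε⇒x≈y _ _ weight-zero)
  ... | inj₂ weight-one  = inj₂ (x∙y⁻¹≈ε⇒x≈y _ _ weight-one)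

  edge-resp-square : ∀ {x y z} → y * y ≡ z * z → Edge F λ′ f x y → Edge F λ′ f x z
  edge-resp-square {x} sq = subst (λ s → (s + - eval F f x) * (λ′ * s + - eval F f x) ≡ 0#) sq

  weight-binary : ∀ x y → weight F f x y ≡ 0 ⊎ weight F f x y ≡ 1
  weight-binary x y with (y * y) ≟ eval F f x
  ... | yes _ = inj₁ refl
  ... | no  _ = inj₂ refl

  weight≡0 : ∀ {x y} → y * y ≡ eval F f x → weight F f x y ≡ 0
  weight≡0 {x} {y} sq with (y * y) ≟ eval F f x
  ... | yes _  = refl
  ... | no  ¬sq = contradiction sq ¬sq

  edge-to-0-weight : ∀ {x} → Edge F λ′ f x 0# → weight F f x 0# ≡ 0
  edge-to-0-weight {x} e with edge-cases e
  ... | inj₁ sq = weight≡0 sq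
  ... | inj₂ λsq = weight≡0 (trans (zeroˡ 0#) (trans (sym (zeroʳ λ′))
                             (trans (cong (λ′ *_) (sym (zeroˡ 0#))) λsq)))

  edge-source-unique : Injective _≡_ _≡_ (eval F f) →
                       ∀ {x y x′ y′} → Edge F λ′ f x y → Edge F λ′ f x′ y′ →
                       y * y ≡ y′ * y′ → weight F f x y ≡ weight F f x′ y′ → x ≡ x′
  edge-source-unique f-inj {x} {y} {x′} {y′} e e′ sq w
    with (y * y) ≟ eval F f x | (y′ * y′) ≟ eval F f x′
  ... | yes a  | yes b  = f-inj (trans (sym a) (trans sq b))
  ... | no  ¬a | no  ¬b = f-inj (trans (sym (weight-one e ¬a))
                                  (trans (cong (λ′ *_) sq) (weight-one e′ ¬b)))
    where
    weight-one : ∀ {x y} → Edge F λ′ f x y → y * y ≢ eval F f x → λ′ * (y * y) ≡ eval F f x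
    weight-one e ¬sq with edge-cases e
    ... | inj₁ sq  = contradiction sq ¬sq
    ... | inj₂ λsq = λsq

nextAux-inject₁ : ∀ {k} (j : Fin (suc k)) → nextAux {suc k} (inject₁ j) ≡ Fin.suc j
nextAux-inject₁ {zero}  Fin.zero    = refl
nextAux-inject₁ {suc k} Fin.zero    = refl
nextAux-inject₁ {suc k} (Fin.suc j) = cong Fin.suc (nextAux-inject₁ j)

next-fromℕ : ∀ k → next (fromℕ k) ≡ Fin.zero
next-fromℕ k with suc (toℕ (fromℕ k)) ℕ.≟ suc k
... | yes _     = refl
... | no  ¬last = contradiction (cong suc (toℕ-fromℕ k)) ¬last

next-inject₁ : ∀ {k} (j : Fin (suc k)) → next (inject₁ j) ≡ Fin.suc j
next-inject₁ {k} j with suc (toℕ (inject₁ j)) ℕ.≟ suc (suc k)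
... | no  _    = nextAux-inject₁ j
... | yes last = contradiction (subst (ℕ._< suc k) j≡1+k (toℕ<n j)) (ℕ.<-irrefl refl)
  where
  j≡1+k : toℕ j ≡ suc k
  j≡1+k = trans (sym (toℕ-inject₁ j)) (ℕ.suc-injective last)

next-surjective : ∀ {m} (t : Fin m) → ∃ λ i → next i ≡ t
next-surjective {suc k}       Fin.zero    = fromℕ k , next-fromℕ k
next-surjective {suc (suc k)} (Fin.suc j) = inject₁ j , next-inject₁ j

module EdgePartners {q : ℕ} (F : FiniteField q)
  (λ′ : FiniteField.Carrier F) (non-square : ¬ IsSquare F λ′)
  (f : Poly F) (f-inj : Injective _≡_ _≡_ (eval F f))
  (C : FiniteField.Carrier F → Set) (component : IsWeakComponent F λ′ f C)
  (H : HamiltonianCycle F λ′ f C) where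
  open FiniteField F
  open FieldProperties F
  open GraphProperties F λ′ f
  open HamiltonianCycle H renaming (len to m)
  open IsWeakComponent component using (maximal)

  target : Fin m → Carrier
  target i = vertex (next i)

  s : Fin m → ℕ
  s = weightSeq F H

  partner-exists : ∀ i → ∃ λ j → target j ≡ - target i
  partner-exists i = j , trans (cong vertex next-j≡t) vertex-t≡-yᵢ
    where
    edge : Edge F λ′ f (vertex i) (- target i)
    edge = edge-resp-square (sym (-x*-x≡x*x (target i))) (edges i)

    -y∈C : C (- target i)
    -y∈C = maximal _ _ (inC i) (step here (inj₁ edge))

    t = proj₁ (covers _ -y∈C)
    vertex-t≡-yᵢ = proj₂ (covers _ -y∈C)
    j = proj₁ (next-surjective t)
    next-j≡t = proj₂ (next-surjective t)

  partner : Fin m → Fin m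
  partner i = proj₁ (partner-exists i)

  target-partner : ∀ i → target (partner i) ≡ - target i
  target-partner i = proj₂ (partner-exists i)

  edge-unique : ∀ {i j} → target i * target i ≡ target j * target j → s i ≡ s j → i ≡ j
  edge-unique sq w = distinct (edge-source-unique f-inj (edges _) (edges _) sq w)

  injective-on-levels : ∀ {i j} → s i ≡ s j → partner i ≡ partner j → i ≡ j
  injective-on-levels {i} {j} w p = edge-unique (cong (λ y → y * y) targets) w
    where
    targets : target i ≡ target j
    targets = -‿injective (trans (sym (target-partner i))
                            (trans (cong target p) (target-partner j)))

  same-level⇒fixed : ∀ {i} → s (partner i) ≡ s i → partner i ≡ i
  same-level⇒fixed {i} w = edge-unique
    (trans (cong (λ y → y * y) (target-partner i)) (-x*-x≡x*x (target i))) w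

  fixed⇒target-zero : ∀ {i} → partner i ≡ i → target i ≡ 0#
  fixed⇒target-zero {i} p = x≡-x⇒x≡0 (non-square⇒1+1≢0 non-square)
    (trans (cong target (sym p)) (target-partner i))

  fixed⇒zero : ∀ {i} → partner i ≡ i → s i ≡ 0
  fixed⇒zero {i} p with target i | fixed⇒target-zero p | edges i
  ... | _ | refl | e = edge-to-0-weight e

  fixed-unique : ∀ {i j} → partner i ≡ i → partner j ≡ j → i ≡ j
  fixed-unique p p′ = edge-unique
    (cong (λ y → y * y) (trans (fixed⇒target-zero p) (sym (fixed⇒target-zero p′))))
    (trans (fixed⇒zero p) (sym (fixed⇒zero p′)))

  weightSeq-binary : ∀ i → s i ≡ 0 ⊎ s i ≡ 1
  weightSeq-binary i = weight-binary (vertex i) (target i)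

theorem2p13 : (p k q : ℕ) → Prime p → p ≢ 2 → 1 ≤ k → q ≡ p ^ k →
    (F : FiniteField q) →
    (λ' : FiniteField.Carrier F) → ¬ IsSquare F λ' →
    (f : Poly F) → IsPermutationPolynomial F f →
    (C : FiniteField.Carrier F → Set) → IsWeakComponent F λ' f C →
    (H : HamiltonianCycle F λ' f C) →
    Balancing (weightSeq F H)
theorem2p13 _ _ _ _ _ _ _ F λ' non-square f (f-inj , _) C component H =
  balancing-by-partners s partner weightSeq-binary injective-on-levels
                        same-level⇒fixed fixed⇒zero fixed-unique
  where open EdgePartners F λ' non-square f f-inj C component H
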